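{- For all $n\ge2$ and all integers $k$ with $0\le k<n$, $$G^{\mathrm{I}}_{2n,2k+2}=G^{\mathrm{I}}_{2n,2k}+\sum_{i=k}^{n-1}G^{\mathrm{I}}_{2n-2,2i}.$$
   Context: For $m\ge1$, $\mathfrak{G}^{\mathrm{I}}_{2m}$ is the set of permutations $\pi=\pi_1\cdots\pi_{2m}$ of $[2m]$ such that every ascent $\pi_i<\pi_{i+1}$ has $\pi_i$ odd and $\pi_{i+1}$ even. For $1\le j\le 2m$, $G^{\mathrm{I}}_{2m,j}$ denotes the number of $\pi\in\mathfrak{G}^{\mathrm{I}}_{2m}$ with $\pi_1=j$, and by convention $G^{\mathrm{I}}_{2m,j}=0$ for $j<1$ or $j>2m$. -}

module Defs where

open import Data.Nat using (ℕ; zero; suc; _+_; _*_; _<ᵇ_; _≡ᵇ_)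
open import Data.Nat.Base using (_%_)
open import Data.Bool using (Bool; true; false; _∧_; _∨_; not)
open import Data.List using (List; []; _∷_; length; filter; concatMap; map; drop; upTo)
open import Data.Nat.ListAction using (sum)
open import Data.Bool.Properties using (T?)
open import Relation.Binary.PropositionalEquality using (_≡_)
open import Function using (_∘_)

range1 : ℕ → List ℕ
range1 N = go N []
  where
  go : ℕ → List ℕ → List ℕ
  go zero acc = acc
  go (suc n) acc = go n (suc n ∷ acc)

insertions : ℕ → List ℕ → List (List ℕ)
insertions x [] = (x ∷ []) ∷ []
insertions x (y ∷ ys) = (x ∷ y ∷ ys) ∷ map (y ∷_) (insertions x ys)

permutations : List ℕ → List (List ℕ)
permutations [] = [] ∷ []
permutations (x ∷ xs) = concatMap (insertions x) (permutations xs)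

isOdd isEven : ℕ → Bool
isOdd n = n % 2 ≡ᵇ 1
isEven n = n % 2 ≡ᵇ 0

goodI : List ℕ → Bool
goodI [] = true
goodI (a ∷ []) = true
goodI (a ∷ b ∷ rest) =
  ((not (a <ᵇ b)) ∨ (isOdd a ∧ isEven b)) ∧ goodI (b ∷ rest)

startsWith : ℕ → List ℕ → Bool
startsWith j [] = false
startsWith j (a ∷ _) = a ≡ᵇ j

-- G N j = G^I_{N,j}: number of permutations π of [N] in 𝔊^I_N with π_1 = j.
-- (Automatically 0 for j < 1 or j > N, since no such permutation starts with j.)
G : ℕ → ℕ → ℕ
G N j = length (filter (λ π → T? (goodI π ∧ startsWith j π)) (permutations (range1 N)))

-- Σ_{i=k}^{n-1} f i  (empty, i.e. 0, when k ≥ n)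
sumFromTo : ℕ → ℕ → (ℕ → ℕ) → ℕ
sumFromTo k n f = sum (map f (drop k (upTo n)))

private
  open import Relation.Binary.PropositionalEquality using (refl)
  t1 : G 4 2 ≡ G 4 0 + sumFromTo 0 2 (λ i → G 2 (2 * i))
  t1 = refl
  t2 : G 6 4 ≡ G 6 2 + sumFromTo 1 3 (λ i → G 4 (2 * i))
  t2 = refl
  t3 : map (G 4) (0 ∷ 1 ∷ 2 ∷ 3 ∷ 4 ∷ 5 ∷ []) ≡ 0 ∷ _ ∷ _ ∷ _ ∷ _ ∷ 0 ∷ []
  t3 = refl

-- Let cont j xs count the orderings τ of the list xs for which j τ is good. Choosing the first value
-- of τ gives cont j xs = [xs = []] + Σ_{h ∈ xs, j → h allowed} cont h (xs - h), and G N j = cont j ([1..N] - j).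
-- Put B = 2k, p = [1..B-1] and q = [B+3..2n]. Then
--   G(2n, B+2) = cont (B+2) (p,B,B+1,q)   and   G(2n, B) = cont B (p,B+1,B+2,q),
-- while shifting the values above B up by 2 turns Σ_{i=k}^{n-1} G(2n-2, 2i) into the number of good
-- orderings of (p,B,q) that start with an even value ≥ B, i.e. cont B (p,q) + Σ_{h ∈ q even} cont h (p,B,q-h).
-- Towards every value outside [B, B+2] the values B and B+2 behave alike; they differ only in that B+2
-- may be followed by B+1. Induction on |p| + |q| through the recurrence, over all p below B and q above
-- B+2, proves for every start j outside [B, B+2]
--   cont j (p,B+1,B+2,q) + [j > B+2] cont j (p,q) = cont j (p,B,B+1,q) + cont j (p,B,q) + cont j (p,B+1,q).
-- Unfolding cont (B+2) (p,B,B+1,q) once and applying this to its terms that continue in p gives the theorem.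

module Submission where

open import Defs
open import Data.Bool using (Bool; true; false; _∧_; _∨_; not)
open import Data.Bool.Properties using (T?; ∧-zeroʳ; ∧-identityʳ)
open import Data.Empty using (⊥-elim)
open import Data.List using (List; []; _∷_; _++_; map; concatMap; filter; length; null; drop; applyUpTo)
open import Data.List.Properties
  using (map-++; map-∘; map-cong; map-cong-local; map-id-local; concatMap-cong; concatMap-map; map-concatMap; ++-assoc)
open import Data.List.Relation.Unary.All as All using (All; []; _∷_)
open import Data.List.Relation.Unary.All.Properties using (map⁺; concat⁺; ++⁺)
open import Data.Nat using (ℕ; zero; suc; pred; _+_; _*_; _∸_; _<_; _≤_; _<ᵇ_; _≤ᵇ_; _≡ᵇ_; _%_; s≤s; z≤n)
open import Data.Nat.ListAction using (sum)
open import Data.Nat.ListAction.Properties using (sum-++)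
open import Data.Nat.Properties
open import Algebra.Properties.CommutativeSemigroup +-commutativeSemigroup using (interchange)
open import Data.Nat.Tactic.RingSolver using (solve-∀)
open import Data.Product using (_×_; _,_; proj₁; proj₂)
open import Data.Sum using (_⊎_; inj₁; inj₂; [_,_]′)
open import Data.Unit using (⊤; tt)
open import Function using (_∘_; _∋_)
open import Relation.Binary.Definitions using (tri<; tri≈; tri>)
open import Relation.Binary.PropositionalEquality
open import Relation.Nullary using (yes; no; proof; contradiction)
open import Relation.Nullary.Reflects using (ofʸ; ofⁿ; det)
open ≡-Reasoning

𝟙 : Bool → ℕ
𝟙 true  = 1
𝟙 false = 0

𝟙-∧ : ∀ a b → 𝟙 (a ∧ b) ≡ 𝟙 a * 𝟙 b
𝟙-∧ true  b = sym (+-identityʳ (𝟙 b))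
𝟙-∧ false b = refl

∑ : {A : Set} → List A → (A → ℕ) → ℕ
∑ xs f = sum (map f xs)

module _ {A : Set} where

  ∑-cong : ∀ {f g : A → ℕ} xs → (∀ x → f x ≡ g x) → ∑ xs f ≡ ∑ xs g
  ∑-cong xs f≗g = cong sum (map-cong f≗g xs)

  ∑-cong-local : ∀ {f g : A → ℕ} {xs} → All (λ x → f x ≡ g x) xs → ∑ xs f ≡ ∑ xs g
  ∑-cong-local eqs = cong sum (map-cong-local eqs)

  ∑-++ : ∀ xs ys (f : A → ℕ) → ∑ (xs ++ ys) f ≡ ∑ xs f + ∑ ys f
  ∑-++ xs ys f = trans (cong sum (map-++ f xs ys)) (sum-++ (map f xs) (map f ys))

  ∑-+ : ∀ xs (f g : A → ℕ) → ∑ xs (λ x → f x + g x) ≡ ∑ xs f + ∑ xs g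
  ∑-+ []       f g = refl
  ∑-+ (x ∷ xs) f g = trans (cong (f x + g x +_) (∑-+ xs f g)) (interchange (f x) (g x) _ _)

  ∑-*ˡ : ∀ xs c (f : A → ℕ) → ∑ xs (λ x → c * f x) ≡ c * ∑ xs f
  ∑-*ˡ []       c f = sym (*-zeroʳ c)
  ∑-*ˡ (x ∷ xs) c f = trans (cong (c * f x +_) (∑-*ˡ xs c f)) (sym (*-distribˡ-+ c (f x) _))

  ∑-*ʳ : ∀ xs c (f : A → ℕ) → ∑ xs (λ x → f x * c) ≡ ∑ xs f * c
  ∑-*ʳ []       c f = refl
  ∑-*ʳ (x ∷ xs) c f = trans (cong (f x * c +_) (∑-*ʳ xs c f)) (sym (*-distribʳ-+ c (f x) _))

  ∑-zero : ∀ {f : A → ℕ} {xs} → All (λ x → f x ≡ 0) xs → ∑ xs f ≡ 0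
  ∑-zero []         = refl
  ∑-zero (fx≡0 ∷ zs) = cong₂ _+_ fx≡0 (∑-zero zs)

  ∑-map : ∀ {B : Set} (g : B → A) xs (f : A → ℕ) → ∑ (map g xs) f ≡ ∑ xs (f ∘ g)
  ∑-map g xs f = cong sum (sym (map-∘ xs))

  ∑-concatMap : ∀ {B : Set} (g : B → List A) xs (f : A → ℕ) →
                ∑ (concatMap g xs) f ≡ ∑ xs (λ x → ∑ (g x) f)
  ∑-concatMap g []       f = refl
  ∑-concatMap g (x ∷ xs) f =
    trans (∑-++ (g x) (concatMap g xs) f) (cong (∑ (g x) f +_) (∑-concatMap g xs f))

  ∑-linear : ∀ {xs} (c : A → ℕ) {f g h k : A → ℕ} → All (λ x → f x ≡ g x + h x + k x) xs →
             ∑ xs (λ x → c x * f x)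
               ≡ ∑ xs (λ x → c x * g x) + ∑ xs (λ x → c x * h x) + ∑ xs (λ x → c x * k x)
  ∑-linear {xs} c {f} {g} {h} {k} eqs = begin
    ∑ xs (λ x → c x * f x)                                ≡⟨ ∑-cong-local (All.map distribute eqs) ⟩
    ∑ xs (λ x → c x * g x + c x * h x + c x * k x)       ≡⟨ ∑-+ xs _ _ ⟩
    ∑ xs (λ x → c x * g x + c x * h x) + ∑ xs (λ x → c x * k x)
                                                          ≡⟨ cong (_+ ∑ xs (λ x → c x * k x)) (∑-+ xs _ _) ⟩
    ∑ xs (λ x → c x * g x) + ∑ xs (λ x → c x * h x) + ∑ xs (λ x → c x * k x) ∎
    where
    distribute : ∀ {x} → f x ≡ g x + h x + k x → c x * f x ≡ c x * g x + c x * h x + c x * k x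
    distribute {x} eq = trans (cong (c x *_) eq)
      (trans (*-distribˡ-+ (c x) _ (k x)) (cong (_+ c x * k x) (*-distribˡ-+ (c x) (g x) (h x))))

∑-comm : ∀ {A B : Set} xs (ys : List B) (f : A → B → ℕ) →
         ∑ xs (λ x → ∑ ys (f x)) ≡ ∑ ys (λ y → ∑ xs (λ x → f x y))
∑-comm []       ys f = sym (∑-zero (All.universal (λ _ → refl) ys))
∑-comm (x ∷ xs) ys f = trans (cong (∑ ys (f x) +_) (∑-comm xs ys f)) (sym (∑-+ ys (f x) _))

prepend : {A : Set} → A → A × List A → A × List A
prepend x (h , r) = h , x ∷ r

picks : {A : Set} → List A → List (A × List A)
picks []       = []
picks (x ∷ xs) = (x , xs) ∷ map (prepend x) (picks xs)

module _ {A : Set} where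

  ∑-picks-++ : ∀ xs ys (f : A × List A → ℕ) →
               ∑ (picks (xs ++ ys)) f
                 ≡ ∑ (picks xs) (λ (h , r) → f (h , r ++ ys)) + ∑ (picks ys) (λ (h , r) → f (h , xs ++ r))
  ∑-picks-++ []       ys f = refl
  ∑-picks-++ (x ∷ xs) ys f = begin
    f (x , xs ++ ys) + ∑ (map (prepend x) (picks (xs ++ ys))) f
      ≡⟨ cong (f (x , xs ++ ys) +_) (trans (∑-map (prepend x) (picks (xs ++ ys)) f) (∑-picks-++ xs ys _)) ⟩
    f (x , xs ++ ys) + (∑ (picks xs) (λ (h , r) → f (h , x ∷ r ++ ys)) + rest)
      ≡⟨ sym (+-assoc (f (x , xs ++ ys)) _ rest) ⟩
    f (x , xs ++ ys) + ∑ (picks xs) (λ (h , r) → f (h , x ∷ r ++ ys)) + rest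
      ≡⟨ cong (λ s → f (x , xs ++ ys) + s + rest) (sym (∑-map (prepend x) (picks xs) _)) ⟩
    ∑ (picks (x ∷ xs)) (λ (h , r) → f (h , r ++ ys)) + rest ∎
    where rest = ∑ (picks ys) (λ (h , r) → f (h , x ∷ xs ++ r))

  ∑-picks-map : ∀ (g : A → A) xs (f : A × List A → ℕ) →
                ∑ (picks (map g xs)) f ≡ ∑ (picks xs) (λ (h , r) → f (g h , map g r))
  ∑-picks-map g []       f = refl
  ∑-picks-map g (x ∷ xs) f = cong (f (g x , map g xs) +_) (begin
    ∑ (map (prepend (g x)) (picks (map g xs))) f            ≡⟨ ∑-map (prepend (g x)) (picks (map g xs)) f ⟩
    ∑ (picks (map g xs)) (λ (h , r) → f (h , g x ∷ r))      ≡⟨ ∑-picks-map g xs _ ⟩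
    ∑ (picks xs) (λ (h , r) → f (g h , g x ∷ map g r))      ≡⟨ sym (∑-map (prepend x) (picks xs) _) ⟩
    ∑ (map (prepend x) (picks xs)) (λ (h , r) → f (g h , map g r)) ∎)

  All-picks : ∀ {P : A → Set} {xs} → All P xs → All (λ (h , r) → P h × All P r) (picks xs)
  All-picks []         = []
  All-picks (px ∷ pxs) = (px , pxs) ∷ map⁺ (All.map (λ (ph , pr) → ph , px ∷ pr) (All-picks pxs))

  picks-length : ∀ (xs : List A) → All (λ (h , r) → suc (length r) ≡ length xs) (picks xs)
  picks-length []       = []
  picks-length (x ∷ xs) = refl ∷ map⁺ (All.map (cong suc) (picks-length xs))

insertions-map : ∀ (g : ℕ → ℕ) x ys → insertions (g x) (map g ys) ≡ map (map g) (insertions x ys)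
insertions-map g x []       = refl
insertions-map g x (y ∷ ys) = cong (map g (x ∷ y ∷ ys) ∷_) (begin
  map (g y ∷_) (insertions (g x) (map g ys))   ≡⟨ cong (map (g y ∷_)) (insertions-map g x ys) ⟩
  map (g y ∷_) (map (map g) (insertions x ys)) ≡⟨ sym (map-∘ (insertions x ys)) ⟩
  map (map g ∘ (y ∷_)) (insertions x ys)       ≡⟨ map-∘ (insertions x ys) ⟩
  map (map g) (map (y ∷_) (insertions x ys))   ∎)

permutations-map : ∀ (g : ℕ → ℕ) xs → permutations (map g xs) ≡ map (map g) (permutations xs)
permutations-map g []       = refl
permutations-map g (x ∷ xs) = begin
  concatMap (insertions (g x)) (permutations (map g xs))
    ≡⟨ cong (concatMap (insertions (g x))) (permutations-map g xs) ⟩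
  concatMap (insertions (g x)) (map (map g) (permutations xs))
    ≡⟨ concatMap-map (insertions (g x)) (map g) (permutations xs) ⟩
  concatMap (insertions (g x) ∘ map g) (permutations xs)
    ≡⟨ concatMap-cong (insertions-map g x) (permutations xs) ⟩
  concatMap (map (map g) ∘ insertions x) (permutations xs)
    ≡⟨ sym (map-concatMap (map g) (insertions x) (permutations xs)) ⟩
  map (map g) (concatMap (insertions x) (permutations xs)) ∎

All-insertions : ∀ {P : ℕ → Set} {x ys} → P x → All P ys → All (All P) (insertions x ys)
All-insertions px []         = (px ∷ []) ∷ []
All-insertions px (py ∷ pys) = (px ∷ py ∷ pys) ∷ map⁺ (All.map (py ∷_) (All-insertions px pys))

All-permutations : ∀ {P : ℕ → Set} {xs} → All P xs → All (All P) (permutations xs)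
All-permutations []         = [] ∷ []
All-permutations (px ∷ pxs) = concat⁺ (map⁺ (All.map (All-insertions px) (All-permutations pxs)))

∑-insertions-tail : ℕ → (List ℕ → ℕ) → List ℕ → ℕ
∑-insertions-tail x f []      = 0
∑-insertions-tail x f (y ∷ σ) = ∑ (insertions x σ) (f ∘ (y ∷_))

∑-insertions : ∀ x σ (f : List ℕ → ℕ) → ∑ (insertions x σ) f ≡ f (x ∷ σ) + ∑-insertions-tail x f σ
∑-insertions x []      f = refl
∑-insertions x (y ∷ σ) f = cong (f (x ∷ y ∷ σ) +_) (∑-map (y ∷_) (insertions x σ) f)

∑-permutations : ∀ x ys (f : List ℕ → ℕ) →
  ∑ (permutations (x ∷ ys)) f ≡ ∑ (picks (x ∷ ys)) (λ (h , r) → ∑ (permutations r) (f ∘ (h ∷_)))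
∑-permutations x ys f = begin
  ∑ (concatMap (insertions x) (permutations ys)) f
    ≡⟨ ∑-concatMap (insertions x) (permutations ys) f ⟩
  ∑ (permutations ys) (λ σ → ∑ (insertions x σ) f)
    ≡⟨ ∑-cong (permutations ys) (λ σ → ∑-insertions x σ f) ⟩
  ∑ (permutations ys) (λ σ → f (x ∷ σ) + ∑-insertions-tail x f σ)
    ≡⟨ ∑-+ (permutations ys) _ _ ⟩
  ∑ (permutations ys) (f ∘ (x ∷_)) + ∑ (permutations ys) (∑-insertions-tail x f)
    ≡⟨ cong (∑ (permutations ys) (f ∘ (x ∷_)) +_) (∑-tails ys) ⟩
  ∑ (permutations ys) (f ∘ (x ∷_)) + ∑ (picks ys) (λ (h , r) → ∑ (permutations (x ∷ r)) (f ∘ (h ∷_)))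
    ≡⟨ cong (∑ (permutations ys) (f ∘ (x ∷_)) +_) (sym (∑-map (prepend x) (picks ys) _)) ⟩
  ∑ (picks (x ∷ ys)) (λ (h , r) → ∑ (permutations r) (f ∘ (h ∷_))) ∎
  where
  -- Grouped by their head h, the insertions of x behind h range over the permutations of x ∷ r.
  ∑-tails : ∀ ys → ∑ (permutations ys) (∑-insertions-tail x f)
                   ≡ ∑ (picks ys) (λ (h , r) → ∑ (permutations (x ∷ r)) (f ∘ (h ∷_)))
  ∑-tails []       = refl
  ∑-tails (y ∷ zs) = trans (∑-permutations y zs (∑-insertions-tail x f))
    (∑-cong (picks (y ∷ zs)) (λ (h , r) → sym (∑-concatMap (insertions x) (permutations r) (f ∘ (h ∷_)))))

-- `goodI (a ∷ b ∷ r)` reduces to `allowed a b ∧ goodI (b ∷ r)`.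
allowed : ℕ → ℕ → Bool
allowed a b = not (a <ᵇ b) ∨ (isOdd a ∧ isEven b)

cont : ℕ → List ℕ → ℕ
cont j xs = ∑ (permutations xs) λ τ → 𝟙 (goodI (j ∷ τ))

cont-unfold : ∀ j xs → cont j xs ≡ 𝟙 (null xs) + ∑ (picks xs) λ (h , r) → 𝟙 (allowed j h) * cont h r
cont-unfold j []       = refl
cont-unfold j (x ∷ xs) = trans (∑-permutations x xs _) (∑-cong (picks (x ∷ xs)) λ (h , r) → begin
  ∑ (permutations r) (λ τ → 𝟙 (allowed j h ∧ goodI (h ∷ τ)))
    ≡⟨ ∑-cong (permutations r) (λ τ → 𝟙-∧ (allowed j h) _) ⟩
  ∑ (permutations r) (λ τ → 𝟙 (allowed j h) * 𝟙 (goodI (h ∷ τ)))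
    ≡⟨ ∑-*ˡ (permutations r) (𝟙 (allowed j h)) _ ⟩
  𝟙 (allowed j h) * cont h r ∎)

<ᵇ-true : ∀ {u v} → u < v → (u <ᵇ v) ≡ true
<ᵇ-true {u} {v} u<v = det (<ᵇ-reflects-< u v) (ofʸ u<v)

<ᵇ-false : ∀ {u v} → v ≤ u → (u <ᵇ v) ≡ false
<ᵇ-false {u} {v} v≤u = det (<ᵇ-reflects-< u v) (ofⁿ (≤⇒≯ v≤u))

≤ᵇ-true : ∀ {u v} → u ≤ v → (u ≤ᵇ v) ≡ true
≤ᵇ-true {u} {v} u≤v = det (≤ᵇ-reflects-≤ u v) (ofʸ u≤v)

≤ᵇ-false : ∀ {u v} → v < u → (u ≤ᵇ v) ≡ false
≤ᵇ-false {u} {v} v<u = det (≤ᵇ-reflects-≤ u v) (ofⁿ (<⇒≱ v<u))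

≡ᵇ-refl : ∀ u → (u ≡ᵇ u) ≡ true
≡ᵇ-refl u = det (proof (u ≟ u)) (ofʸ refl)

≡ᵇ-false : ∀ {u v} → u ≢ v → (u ≡ᵇ v) ≡ false
≡ᵇ-false {u} {v} u≢v = det (proof (u ≟ v)) (ofⁿ u≢v)

allowed-descent : ∀ {u v} → v < u → allowed u v ≡ true
allowed-descent v<u rewrite <ᵇ-false (<⇒≤ v<u) = refl

allowed-ascent : ∀ {u v} → u < v → allowed u v ≡ isOdd u ∧ isEven v
allowed-ascent u<v rewrite <ᵇ-true u<v = refl

module Relabelling {P : ℕ → Set} (f : ℕ → ℕ)
                   (f-mono : ∀ {u v} → P u → P v → u < v → f u < f v)
                   (f-parity : ∀ {u} → P u → f u % 2 ≡ u % 2) where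

  <ᵇ-preserved : ∀ {u v} → P u → P v → (f u <ᵇ f v) ≡ (u <ᵇ v)
  <ᵇ-preserved {u} {v} pu pv with <-cmp u v
  ... | tri< u<v _ _  = trans (<ᵇ-true (f-mono pu pv u<v)) (sym (<ᵇ-true u<v))
  ... | tri≈ _ refl _ = trans (<ᵇ-false (≤-refl {f u})) (sym (<ᵇ-false (≤-refl {u})))
  ... | tri> _ _ v<u  = trans (<ᵇ-false (<⇒≤ (f-mono pv pu v<u))) (sym (<ᵇ-false (<⇒≤ v<u)))

  allowed-preserved : ∀ {u v} → P u → P v → allowed (f u) (f v) ≡ allowed u v
  allowed-preserved pu pv rewrite <ᵇ-preserved pu pv | f-parity pu | f-parity pv = refl

  goodI-preserved : ∀ {xs} → All P xs → goodI (map f xs) ≡ goodI xs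
  goodI-preserved []             = refl
  goodI-preserved (_ ∷ [])       = refl
  goodI-preserved (pu ∷ pv ∷ ps) = cong₂ _∧_ (allowed-preserved pu pv) (goodI-preserved (pv ∷ ps))

  cont-preserved : ∀ {j xs} → P j → All P xs → cont (f j) (map f xs) ≡ cont j xs
  cont-preserved {j} {xs} pj pxs = begin
    ∑ (permutations (map f xs)) (λ τ → 𝟙 (goodI (f j ∷ τ)))
      ≡⟨ cong (λ τs → ∑ τs (λ τ → 𝟙 (goodI (f j ∷ τ)))) (permutations-map f xs) ⟩
    ∑ (map (map f) (permutations xs)) (λ τ → 𝟙 (goodI (f j ∷ τ)))
      ≡⟨ ∑-map (map f) (permutations xs) _ ⟩
    ∑ (permutations xs) (λ τ → 𝟙 (goodI (map f (j ∷ τ))))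
      ≡⟨ ∑-cong-local (All.map (λ pτ → cong 𝟙 (goodI-preserved (pj ∷ pτ))) (All-permutations pxs)) ⟩
    cont j xs ∎

interval : ℕ → ℕ → List ℕ
interval a zero    = []
interval a (suc l) = a ∷ interval (suc a) l

interval-∷ʳ : ∀ a l → interval a (suc l) ≡ interval a l ++ (a + l ∷ [])
interval-∷ʳ a zero    = cong (λ b → b ∷ []) (sym (+-identityʳ a))
interval-∷ʳ a (suc l) =
  cong (a ∷_) (trans (interval-∷ʳ (suc a) l) (cong (λ b → interval (suc a) l ++ (b ∷ [])) (sym (+-suc a l))))

interval-++ : ∀ a x y → interval a (x + y) ≡ interval a x ++ interval (a + x) y
interval-++ a zero    y = cong (λ b → interval b y) (sym (+-identityʳ a))
interval-++ a (suc x) y =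
  cong (a ∷_) (trans (interval-++ (suc a) x y) (cong (λ b → interval (suc a) x ++ interval b y) (sym (+-suc a x))))

interval-lower : ∀ a l → All (a ≤_) (interval a l)
interval-lower a zero    = []
interval-lower a (suc l) = ≤-refl ∷ All.map (λ a<u → <⇒≤ a<u) (interval-lower (suc a) l)

interval-upper : ∀ a l → All (_< a + l) (interval a l)
interval-upper a zero    = []
interval-upper a (suc l) = subst (a <_) (sym (+-suc a l)) (s≤s (m≤m+n a l))
                         ∷ All.map (λ {u} → subst (u <_) (sym (+-suc a l))) (interval-upper (suc a) l)

applyUpTo-interval : ∀ {f} a l → (∀ i → f i ≡ a + i) → applyUpTo f l ≡ interval a l
applyUpTo-interval a zero    f≗ = refl
applyUpTo-interval a (suc l) f≗ = cong₂ _∷_ (trans (f≗ 0) (+-identityʳ a))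
  (applyUpTo-interval (suc a) l (λ i → trans (f≗ (suc i)) (+-suc a i)))

drop-interval : ∀ k a l → drop k (interval a (k + l)) ≡ interval (a + k) l
drop-interval zero    a l = cong (λ b → interval b l) (sym (+-identityʳ a))
drop-interval (suc k) a l = trans (drop-interval k (suc a) l) (cong (λ b → interval b l) (sym (+-suc a k)))

sumFromTo-interval : ∀ k l f → sumFromTo k (k + l) f ≡ ∑ (interval k l) f
sumFromTo-interval k l f = cong (λ xs → ∑ xs f)
  (trans (cong (drop k) (applyUpTo-interval 0 (k + l) (λ _ → refl))) (drop-interval k 0 l))

module _ (loop : ℕ → ℕ → List ℕ → List ℕ)
         (loop-zero : ∀ m acc → loop m zero acc ≡ acc)
         (loop-suc : ∀ m n acc → loop m (suc n) acc ≡ loop m n (suc n ∷ acc)) where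

  loop-interval : ∀ m n acc → loop m n acc ≡ interval 1 n ++ acc
  loop-interval m zero    acc = loop-zero m acc
  loop-interval m (suc n) acc = begin
    loop m (suc n) acc                     ≡⟨ loop-suc m n acc ⟩
    loop m n (suc n ∷ acc)                 ≡⟨ loop-interval m n (suc n ∷ acc) ⟩
    interval 1 n ++ (suc n ∷ acc)          ≡⟨ sym (++-assoc (interval 1 n) (suc n ∷ []) acc) ⟩
    (interval 1 n ++ (suc n ∷ [])) ++ acc  ≡⟨ cong (_++ acc) (sym (interval-∷ʳ 1 n)) ⟩
    interval 1 (suc n) ++ acc              ∎

-- `range1` runs an accumulator loop local to Defs, which cannot be named here; since its unfolding
-- equations hold by `refl`, it is recovered as the solution of this metavariable.
mutual
  range1-loop : ℕ → ℕ → List ℕ → List ℕ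
  range1-loop = _

  range1-suc : ∀ n → range1 (suc n) ≡ interval 1 n ++ (suc n ∷ [])
  range1-suc n with (List ℕ ∋ suc n ∷ [])
  ... | acc with suc n
  ... | m = loop-interval range1-loop (λ _ _ → refl) (λ _ _ _ → refl) m n acc

range1-interval : ∀ n → range1 n ≡ interval 1 n
range1-interval zero    = refl
range1-interval (suc n) = trans (range1-suc n) (sym (interval-∷ʳ 1 n))

length-filter : ∀ {A : Set} (b : A → Bool) xs → length (filter (λ x → T? (b x)) xs) ≡ ∑ xs (𝟙 ∘ b)
length-filter b []       = refl
length-filter b (x ∷ xs) with b x
... | true  = cong suc (length-filter b xs)
... | false = length-filter b xs

G-picks : ∀ N j → G N j ≡ ∑ (picks (interval 1 N)) λ (h , r) → 𝟙 (h ≡ᵇ j) * cont h r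
G-picks zero    j = refl
G-picks (suc N) j = begin
  G (suc N) j
    ≡⟨ length-filter (λ π → goodI π ∧ startsWith j π) (permutations (range1 (suc N))) ⟩
  ∑ (permutations (range1 (suc N))) (λ π → 𝟙 (goodI π ∧ startsWith j π))
    ≡⟨ cong (λ xs → ∑ (permutations xs) (λ π → 𝟙 (goodI π ∧ startsWith j π))) (range1-interval (suc N)) ⟩
  ∑ (permutations (interval 1 (suc N))) (λ π → 𝟙 (goodI π ∧ startsWith j π))
    ≡⟨ ∑-permutations 1 (interval 2 N) _ ⟩
  ∑ (picks (interval 1 (suc N))) (λ (h , r) → ∑ (permutations r) (λ τ → 𝟙 (goodI (h ∷ τ) ∧ (h ≡ᵇ j))))
    ≡⟨ ∑-cong (picks (interval 1 (suc N))) (λ (h , r) → startsWith-weight h r) ⟩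
  ∑ (picks (interval 1 (suc N))) (λ (h , r) → 𝟙 (h ≡ᵇ j) * cont h r) ∎
  where
  startsWith-weight : ∀ h r →
    ∑ (permutations r) (λ τ → 𝟙 (goodI (h ∷ τ) ∧ (h ≡ᵇ j))) ≡ 𝟙 (h ≡ᵇ j) * cont h r
  startsWith-weight h r = trans
    (∑-cong (permutations r) λ τ → trans (𝟙-∧ (goodI (h ∷ τ)) _) (*-comm (𝟙 (goodI (h ∷ τ))) _))
    (∑-*ˡ (permutations r) (𝟙 (h ≡ᵇ j)) _)

∑-picks-select : ∀ {j} p q → All (_≢ j) p → All (_≢ j) q →
                 ∑ (picks (p ++ j ∷ q)) (λ (h , r) → 𝟙 (h ≡ᵇ j) * cont h r) ≡ cont j (p ++ q)
∑-picks-select {j} p q p≢j q≢j = begin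
  ∑ (picks (p ++ j ∷ q)) F
    ≡⟨ ∑-picks-++ p (j ∷ q) F ⟩
  ∑ (picks p) (λ (h , r) → F (h , r ++ j ∷ q))
    + (F (j , p ++ q) + ∑ (map (prepend j) (picks q)) (λ (h , r) → F (h , p ++ r)))
    ≡⟨ cong₂ (λ s t → s + (F (j , p ++ q) + t))
             (∑-zero (All.map (λ {(h , r)} (h≢j , _) → not-j h≢j (cont h (r ++ j ∷ q))) (All-picks p≢j)))
             (trans (∑-map (prepend j) (picks q) _)
                    (∑-zero (All.map (λ {(h , r)} (h≢j , _) → not-j h≢j (cont h (p ++ j ∷ r))) (All-picks q≢j)))) ⟩
  F (j , p ++ q) + 0
    ≡⟨ trans (+-identityʳ _) (cong (λ b → 𝟙 b * cont j (p ++ q)) (≡ᵇ-refl j)) ⟩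
  1 * cont j (p ++ q)
    ≡⟨ *-identityˡ _ ⟩
  cont j (p ++ q) ∎
  where
  F : ℕ × List ℕ → ℕ
  F (h , r) = 𝟙 (h ≡ᵇ j) * cont h r
  not-j : ∀ {h} → h ≢ j → ∀ c → 𝟙 (h ≡ᵇ j) * c ≡ 0
  not-j h≢j c = cong (λ b → 𝟙 b * c) (≡ᵇ-false h≢j)

G-cont : ∀ {N j} xs ys → interval 1 N ≡ xs ++ j ∷ ys → All (_< j) xs → All (j <_) ys →
         G N j ≡ cont j (xs ++ ys)
G-cont {N} {j} xs ys layout xs<j j<ys = begin
  G N j
    ≡⟨ G-picks N j ⟩
  ∑ (picks (interval 1 N)) (λ (h , r) → 𝟙 (h ≡ᵇ j) * cont h r)
    ≡⟨ cong (λ L → ∑ (picks L) (λ (h , r) → 𝟙 (h ≡ᵇ j) * cont h r)) layout ⟩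
  ∑ (picks (xs ++ j ∷ ys)) (λ (h , r) → 𝟙 (h ≡ᵇ j) * cont h r)
    ≡⟨ ∑-picks-select xs ys (All.map <⇒≢ xs<j) (All.map (≢-sym ∘ <⇒≢) j<ys) ⟩
  cont j (xs ++ ys) ∎

G-zero : ∀ N → G N 0 ≡ 0
G-zero N = trans (G-picks N 0) (∑-zero (All.map not-zero (All-picks (interval-lower 1 N))))
  where
  not-zero : ∀ {(h , r) : ℕ × List ℕ} → 1 ≤ h × All (1 ≤_) r → 𝟙 (h ≡ᵇ 0) * cont h r ≡ 0
  not-zero {h , r} (0<h , _) = cong (λ b → 𝟙 b * cont h r) (≡ᵇ-false (≢-sym (<⇒≢ 0<h)))

data Even : ℕ → Set where
  even-zero : Even 0
  even-+2   : ∀ {n} → Even n → Even (2 + n)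

even-double : ∀ k → Even (2 * k)
even-double zero    = even-zero
even-double (suc k) = subst Even (sym (*-suc 2 k)) (even-+2 (even-double k))

Even⇒%2≡0 : ∀ {n} → Even n → n % 2 ≡ 0
Even⇒%2≡0 even-zero    = refl
Even⇒%2≡0 (even-+2 en) = Even⇒%2≡0 en

Even⇒suc%2≡1 : ∀ {n} → Even n → suc n % 2 ≡ 1
Even⇒suc%2≡1 even-zero    = refl
Even⇒suc%2≡1 (even-+2 en) = Even⇒suc%2≡1 en

isEvenFrom : ℕ → ℕ → Bool
isEvenFrom d h = isEven h ∧ (d ≤ᵇ h)

startsEvenFrom : ℕ → List ℕ → ℕ
startsEvenFrom d xs = ∑ (picks xs) λ (h , r) → 𝟙 (isEvenFrom d h) * cont h r

-- Matching two levels of `Even` makes `_≤ᵇ_` compute on both sides.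
isEvenFrom-step : ∀ {d} → Even d → ∀ h → 𝟙 (h ≡ᵇ d) + 𝟙 (isEvenFrom (2 + d) h) ≡ 𝟙 (isEvenFrom d h)
isEvenFrom-step even-zero               0             = refl
isEvenFrom-step even-zero               1             = refl
isEvenFrom-step even-zero               (suc (suc h)) = refl
isEvenFrom-step (even-+2 _)             0             = refl
isEvenFrom-step (even-+2 _)             1             = refl
isEvenFrom-step (even-+2 even-zero)     (suc (suc h)) = isEvenFrom-step even-zero h
isEvenFrom-step (even-+2 (even-+2 ed))  (suc (suc h)) = isEvenFrom-step (even-+2 ed) h

count-evens : ∀ k l h → h < 2 * (k + l) →
              ∑ (interval k l) (λ i → 𝟙 (h ≡ᵇ 2 * i)) ≡ 𝟙 (isEvenFrom (2 * k) h)
count-evens k zero    h h<2k+0 = cong 𝟙 (sym (trans (cong (isEven h ∧_) (≤ᵇ-false h<2k)) (∧-zeroʳ (isEven h))))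
  where h<2k = subst (λ m → h < 2 * m) (+-identityʳ k) h<2k+0
count-evens k (suc l) h bound = begin
  𝟙 (h ≡ᵇ 2 * k) + ∑ (interval (suc k) l) (λ i → 𝟙 (h ≡ᵇ 2 * i))
    ≡⟨ cong (𝟙 (h ≡ᵇ 2 * k) +_) (count-evens (suc k) l h (subst (λ m → h < 2 * m) (+-suc k l) bound)) ⟩
  𝟙 (h ≡ᵇ 2 * k) + 𝟙 (isEvenFrom (2 * suc k) h)
    ≡⟨ cong (λ d → 𝟙 (h ≡ᵇ 2 * k) + 𝟙 (isEvenFrom d h)) (*-suc 2 k) ⟩
  𝟙 (h ≡ᵇ 2 * k) + 𝟙 (isEvenFrom (2 + 2 * k) h)
    ≡⟨ isEvenFrom-step (even-double k) h ⟩
  𝟙 (isEvenFrom (2 * k) h) ∎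

shift : ℕ → ℕ → ℕ
shift B u with u ≤? B
... | yes _ = u
... | no  _ = 2 + u

module _ (B : ℕ) where

  shift-mono : ∀ {u v} → u < v → shift B u < shift B v
  shift-mono {u} {v} u<v with u ≤? B | v ≤? B
  ... | yes _   | yes _   = u<v
  ... | yes _   | no  _   = m<n⇒m<1+n (m<n⇒m<1+n u<v)
  ... | no  u≰B | yes v≤B = contradiction (≤-trans (<⇒≤ u<v) v≤B) u≰B
  ... | no  _   | no  _   = s≤s (s≤s u<v)

  shift-parity : ∀ u → shift B u % 2 ≡ u % 2
  shift-parity u with u ≤? B
  ... | yes _ = refl
  ... | no  _ = refl

  shift-≤ : ∀ {u} → u ≤ B → shift B u ≡ u
  shift-≤ {u} u≤B with u ≤? B
  ... | yes _   = refl
  ... | no  u≰B = contradiction u≤B u≰B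

  shift-> : ∀ {u} → B < u → shift B u ≡ 2 + u
  shift-> {u} B<u with u ≤? B
  ... | yes u≤B = contradiction u≤B (<⇒≱ B<u)
  ... | no  _   = refl

  isEvenFrom-shift : ∀ u → isEvenFrom B (shift B u) ≡ isEvenFrom B u
  isEvenFrom-shift u with u ≤? B
  ... | yes _   = refl
  ... | no  u≰B = cong (isEven u ∧_) (trans (≤ᵇ-true (≤-trans B≤u (m≤n+m u 2))) (sym (≤ᵇ-true B≤u)))
    where B≤u = <⇒≤ (≰⇒> u≰B)

  open Relabelling {P = λ _ → ⊤} (shift B) (λ _ _ → shift-mono) (λ {u} _ → shift-parity u)
    using () renaming (cont-preserved to cont-shift)

  startsEvenFrom-shift : ∀ xs → startsEvenFrom B (map (shift B) xs) ≡ startsEvenFrom B xs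
  startsEvenFrom-shift xs = trans (∑-picks-map (shift B) xs _) (∑-cong (picks xs) λ (h , r) →
    cong₂ (λ b c → 𝟙 b * c) (isEvenFrom-shift h) (cont-shift tt (All.universal (λ _ → tt) r)))

  map-shift-interval : ∀ l → map (shift B) (interval 1 (B + l)) ≡ interval 1 B ++ interval (3 + B) l
  map-shift-interval l = begin
    map (shift B) (interval 1 (B + l))
      ≡⟨ cong (map (shift B)) (interval-++ 1 B l) ⟩
    map (shift B) (interval 1 B ++ interval (1 + B) l)
      ≡⟨ map-++ (shift B) (interval 1 B) _ ⟩
    map (shift B) (interval 1 B) ++ map (shift B) (interval (1 + B) l)
      ≡⟨ cong₂ _++_ (map-id-local (All.map (λ u<1+B → shift-≤ (m<1+n⇒m≤n u<1+B)) (interval-upper 1 B)))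
                    (map-shift-above (1 + B) l ≤-refl) ⟩
    interval 1 B ++ interval (3 + B) l ∎
    where
    map-shift-above : ∀ a l → B < a → map (shift B) (interval a l) ≡ interval (2 + a) l
    map-shift-above a zero    _   = refl
    map-shift-above a (suc l) B<a = cong₂ _∷_ (shift-> B<a) (map-shift-above (suc a) l (m<n⇒m<1+n B<a))

sumFromTo-startsEvenFrom : ∀ k m →
  sumFromTo k (k + suc m) (λ i → G (2 * (k + suc m) ∸ 2) (2 * i))
    ≡ startsEvenFrom (2 * k) (interval 1 (2 * k) ++ interval (3 + 2 * k) (2 * m))
sumFromTo-startsEvenFrom k m = begin
  sumFromTo k (k + suc m) (λ i → G (2 * (k + suc m) ∸ 2) (2 * i))
    ≡⟨ sumFromTo-interval k (suc m) _ ⟩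
  ∑ I (λ i → G (2 * (k + suc m) ∸ 2) (2 * i))
    ≡⟨ ∑-cong I (λ i → trans (cong (λ N → G N (2 * i)) size) (G-picks N (2 * i))) ⟩
  ∑ I (λ i → ∑ (picks L) (λ (h , r) → 𝟙 (h ≡ᵇ 2 * i) * cont h r))
    ≡⟨ ∑-comm I (picks L) _ ⟩
  ∑ (picks L) (λ (h , r) → ∑ I (λ i → 𝟙 (h ≡ᵇ 2 * i) * cont h r))
    ≡⟨ ∑-cong (picks L) (λ (h , r) → ∑-*ʳ I (cont h r) (λ i → 𝟙 (h ≡ᵇ 2 * i))) ⟩
  ∑ (picks L) (λ (h , r) → ∑ I (λ i → 𝟙 (h ≡ᵇ 2 * i)) * cont h r)
    ≡⟨ ∑-cong-local (All.map counted (All-picks (interval-upper 1 N))) ⟩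
  startsEvenFrom (2 * k) L
    ≡⟨ sym (startsEvenFrom-shift (2 * k) L) ⟩
  startsEvenFrom (2 * k) (map (shift (2 * k)) L)
    ≡⟨ cong (startsEvenFrom (2 * k)) shift-L ⟩
  startsEvenFrom (2 * k) (interval 1 (2 * k) ++ interval (3 + 2 * k) (2 * m)) ∎
  where
  N = 2 * (k + m)
  L = interval 1 N
  I = interval k (suc m)
  double-suc : 2 * (k + suc m) ≡ 2 + N
  double-suc = trans (cong (2 *_) (+-suc k m)) (*-suc 2 (k + m))
  size : 2 * (k + suc m) ∸ 2 ≡ N
  size = cong (_∸ 2) double-suc
  counted : ∀ {(h , r) : ℕ × List ℕ} → h < 1 + N × All (_< 1 + N) r →
            ∑ I (λ i → 𝟙 (h ≡ᵇ 2 * i)) * cont h r ≡ 𝟙 (isEvenFrom (2 * k) h) * cont h r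
  counted {h , r} (h<1+N , _) = cong (_* cont h r)
    (count-evens k (suc m) h (subst (h <_) (sym double-suc) (m<n⇒m<1+n h<1+N)))
  shift-L : map (shift (2 * k)) L ≡ interval 1 (2 * k) ++ interval (3 + 2 * k) (2 * m)
  shift-L = trans (cong (λ n → map (shift (2 * k)) (interval 1 n)) (*-distribˡ-+ 2 k m))
                  (map-shift-interval (2 * k) (2 * m))

lower : ℕ → ℕ → ℕ
lower B u with u ≟ 2 + B
... | yes _ = B
... | no  _ = u

module _ (B : ℕ) where

  Apart : ℕ → Set
  Apart u = u < B ⊎ 1 + B < u

  lower-mono : ∀ {u v} → Apart u → Apart v → u < v → lower B u < lower B v
  lower-mono {u} {v} au av u<v with u ≟ 2 + B | v ≟ 2 + B
  ... | yes refl | yes refl = ⊥-elim (<-irrefl refl u<v)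
  ... | yes refl | no  _    = <-trans (m<n⇒m<1+n (n<1+n B)) u<v
  ... | no  _    | yes refl = [ (λ u<B → u<B) , (λ 1+B<u → ⊥-elim (<⇒≱ 1+B<u (m<1+n⇒m≤n u<v))) ]′ au
  ... | no  _    | no  _    = u<v

  lower-parity : ∀ u → lower B u % 2 ≡ u % 2
  lower-parity u with u ≟ 2 + B
  ... | yes refl = refl
  ... | no  _    = refl

  lower-B+2 : lower B (2 + B) ≡ B
  lower-B+2 with (2 + B) ≟ 2 + B
  ... | yes _  = refl
  ... | no  ne = contradiction refl ne

  lower-fixed : ∀ {u} → u ≢ 2 + B → lower B u ≡ u
  lower-fixed {u} u≢ with u ≟ 2 + B
  ... | yes eq = contradiction eq u≢
  ... | no  _  = refl

+-interchange₃ : ∀ a b c d e f → (a + b + c) + (d + e + f) ≡ (a + d) + (b + e) + (c + f)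
+-interchange₃ a b c d e f =
  trans (interchange (a + b) c (d + e) f) (cong (_+ (c + f)) (interchange a b d e))

private
  +-rotate : ∀ a b c d → a + (b + c) + d ≡ a + (b + d) + c
  +-rotate = solve-∀

  +-detach : ∀ a b x c → a + (b + x) + c ≡ a + b + (c + x)
  +-detach = solve-∀

-- Assembles an identity between totals b + (m + a) from identities between their components;
-- X is transferred from the a-components to the m-components.
combine : ∀ {I : Set} (b m a : I → ℕ) (i₀ i₁ i₂ i₃ : I) {X E : ℕ} →
  b i₀ ≡ b i₁ + b i₂ + b i₃ → m i₀ + E ≡ m i₁ + m i₂ + m i₃ + X → a i₀ + X ≡ a i₁ + a i₂ + a i₃ →
  b i₀ + (m i₀ + a i₀) + E ≡ b i₁ + (m i₁ + a i₁) + (b i₂ + (m i₂ + a i₂)) + (b i₃ + (m i₃ + a i₃))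
combine b m a i₀ i₁ i₂ i₃ {X} {E} hb hm ha = begin
  b i₀ + (m i₀ + a i₀) + E                     ≡⟨ +-rotate (b i₀) (m i₀) (a i₀) E ⟩
  b i₀ + (m i₀ + E) + a i₀                     ≡⟨ cong₂ (λ s t → s + t + a i₀) hb hm ⟩
  Σb + (Σm + X) + a i₀                         ≡⟨ +-detach Σb Σm X (a i₀) ⟩
  Σb + Σm + (a i₀ + X)                         ≡⟨ cong (Σb + Σm +_) ha ⟩
  Σb + Σm + Σa                                 ≡⟨ cong (_+ Σa) (+-interchange₃ (b i₁) (b i₂) (b i₃) _ _ _) ⟩
  S i₁ + S i₂ + S i₃ + Σa                      ≡⟨ +-interchange₃ (S i₁) (S i₂) (S i₃) (a i₁) (a i₂) (a i₃) ⟩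
  S i₁ + a i₁ + (S i₂ + a i₂) + (S i₃ + a i₃)  ≡⟨ cong₂ _+_ (cong₂ _+_ (assoc i₁) (assoc i₂)) (assoc i₃) ⟩
  b i₁ + (m i₁ + a i₁) + (b i₂ + (m i₂ + a i₂)) + (b i₃ + (m i₃ + a i₃)) ∎
  where
  Σb = b i₁ + b i₂ + b i₃
  Σm = m i₁ + m i₂ + m i₃
  Σa = a i₁ + a i₂ + a i₃
  S = λ i → b i + m i
  assoc = λ i → +-assoc (b i) (m i) (a i)

null-++-∷ : ∀ (xs : List ℕ) y ys → null (xs ++ y ∷ ys) ≡ false
null-++-∷ []       y ys = refl
null-++-∷ (x ∷ xs) y ys = refl

module Crossing (B : ℕ) (B-even : Even B) where

  Low High Outside : ℕ → Set
  Low h = h < B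
  High h = 2 + B < h
  Outside h = Low h ⊎ High h

  B<B+2 : B < 2 + B
  B<B+2 = m<n⇒m<1+n (n<1+n B)

  B-isEven : isEven B ≡ true
  B-isEven = cong (_≡ᵇ 0) (Even⇒%2≡0 B-even)

  B-isOdd : isOdd B ≡ false
  B-isOdd = cong (_≡ᵇ 1) (Even⇒%2≡0 B-even)

  B+1-isOdd : isOdd (1 + B) ≡ true
  B+1-isOdd = cong (_≡ᵇ 1) (Even⇒suc%2≡1 B-even)

  B+1-isEven : isEven (1 + B) ≡ false
  B+1-isEven = cong (_≡ᵇ 0) (Even⇒suc%2≡1 B-even)

  Low-to-B : ∀ {j} → Low j → allowed j B ≡ isOdd j
  Low-to-B {j} j<B = trans (allowed-ascent j<B) (trans (cong (isOdd j ∧_) B-isEven) (∧-identityʳ (isOdd j)))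

  Low-to-B+1 : ∀ {j} → Low j → allowed j (1 + B) ≡ false
  Low-to-B+1 {j} j<B =
    trans (allowed-ascent (m<n⇒m<1+n j<B)) (trans (cong (isOdd j ∧_) B+1-isEven) (∧-zeroʳ (isOdd j)))

  Low-to-B+2 : ∀ {j} → Low j → allowed j (2 + B) ≡ isOdd j
  Low-to-B+2 {j} j<B =
    trans (allowed-ascent (<-trans j<B B<B+2)) (trans (cong (isOdd j ∧_) B-isEven) (∧-identityʳ (isOdd j)))

  B-to-B+1 : allowed B (1 + B) ≡ false
  B-to-B+1 = trans (allowed-ascent (n<1+n B)) (cong (_∧ isEven (1 + B)) B-isOdd)

  B-to-B+2 : allowed B (2 + B) ≡ false
  B-to-B+2 = trans (allowed-ascent B<B+2) (cong (_∧ isEven (2 + B)) B-isOdd)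

  B+1-to-B+2 : allowed (1 + B) (2 + B) ≡ true
  B+1-to-B+2 = trans (allowed-ascent (n<1+n (1 + B))) (cong₂ _∧_ B+1-isOdd B-isEven)

  descent-weight : ∀ {j h} c → h < j → 𝟙 (allowed j h) * c ≡ c
  descent-weight c h<j = trans (cong (λ b → 𝟙 b * c) (allowed-descent h<j)) (*-identityˡ c)

  Outside⇒Apart : ∀ {u} → Outside u → Apart B u
  Outside⇒Apart (inj₁ u<B)   = inj₁ u<B
  Outside⇒Apart (inj₂ B+2<u) = inj₂ (<-trans (n<1+n (1 + B)) B+2<u)

  Outside⇒≢B+2 : ∀ {u} → Outside u → u ≢ 2 + B
  Outside⇒≢B+2 (inj₁ u<B)   refl = <-asym u<B B<B+2
  Outside⇒≢B+2 (inj₂ B+2<u) refl = <-irrefl refl B+2<u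

  open Relabelling {P = Apart B} (lower B) (lower-mono B) (λ {u} _ → lower-parity B u)
    using () renaming (cont-preserved to cont-lower)

  lower-fixes : ∀ {xs} → All Outside xs → map (lower B) xs ≡ xs
  lower-fixes oxs = map-id-local (All.map (λ ou → lower-fixed B (Outside⇒≢B+2 ou)) oxs)

  B+2↦B-first : ∀ {xs} → All Outside xs → cont (2 + B) xs ≡ cont B xs
  B+2↦B-first {xs} oxs = begin
    cont (2 + B) xs                            ≡⟨ sym (cont-lower (inj₂ (n<1+n (1 + B))) (All.map Outside⇒Apart oxs)) ⟩
    cont (lower B (2 + B)) (map (lower B) xs)  ≡⟨ cong₂ cont (lower-B+2 B) (lower-fixes oxs) ⟩
    cont B xs                                  ∎

  B+2↦B-inside : ∀ {j xs ys} → Outside j → All Outside xs → All Outside ys →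
                 cont j (xs ++ 2 + B ∷ ys) ≡ cont j (xs ++ B ∷ ys)
  B+2↦B-inside {j} {xs} {ys} oj oxs oys = begin
    cont j (xs ++ 2 + B ∷ ys)                            ≡⟨ sym (cont-lower (Outside⇒Apart oj) apart) ⟩
    cont (lower B j) (map (lower B) (xs ++ 2 + B ∷ ys))  ≡⟨ cong₂ cont (lower-fixed B (Outside⇒≢B+2 oj)) lowered ⟩
    cont j (xs ++ B ∷ ys)                                ∎
    where
    apart = ++⁺ (All.map Outside⇒Apart oxs) (inj₂ (n<1+n (1 + B)) ∷ All.map Outside⇒Apart oys)
    lowered : map (lower B) (xs ++ 2 + B ∷ ys) ≡ xs ++ B ∷ ys
    lowered = trans (map-++ (lower B) xs (2 + B ∷ ys))
                    (cong₂ _++_ (lower-fixes oxs) (cong₂ _∷_ (lower-B+2 B) (lower-fixes oys)))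

  crossing-rhs : ℕ → List ℕ → List ℕ → ℕ
  crossing-rhs j p q = cont j (p ++ B ∷ 1 + B ∷ q) + cont j (p ++ B ∷ q) + cont j (p ++ 1 + B ∷ q)

  LowCrossing HighCrossing : ℕ → List ℕ → List ℕ → Set
  LowCrossing  j p q = cont j (p ++ 1 + B ∷ 2 + B ∷ q) ≡ crossing-rhs j p q
  HighCrossing j p q = cont j (p ++ 1 + B ∷ 2 + B ∷ q) + cont j (p ++ q) ≡ crossing-rhs j p q

  module Frame (p q : List ℕ) (p-low : All Low p) (q-high : All High q) where

    ⟪_⟫ : List ℕ → List ℕ
    ⟪ M ⟫ = p ++ M ++ q

    below middle above : ℕ → List ℕ → ℕ
    below  j M = ∑ (picks p) λ (h , r) → 𝟙 (allowed j h) * cont h (r ++ M ++ q)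
    middle j M = ∑ (picks M) λ (h , r) → 𝟙 (allowed j h) * cont h ⟪ r ⟫
    above  j M = ∑ (picks q) λ (h , r) → 𝟙 (allowed j h) * cont h (p ++ M ++ r)

    evenAbove : List ℕ → ℕ
    evenAbove M = ∑ (picks q) λ (h , r) → 𝟙 (isEven h) * cont h (p ++ M ++ r)

    cont-split : ∀ j M → cont j ⟪ M ⟫ ≡ 𝟙 (null ⟪ M ⟫) + (below j M + (middle j M + above j M))
    cont-split j M = trans (cont-unfold j ⟪ M ⟫) (cong (𝟙 (null ⟪ M ⟫) +_)
      (trans (∑-picks-++ p (M ++ q) _) (cong (below j M +_) (∑-picks-++ M q _))))

    cont-split⁺ : ∀ j m M → cont j ⟪ m ∷ M ⟫ ≡ below j (m ∷ M) + (middle j (m ∷ M) + above j (m ∷ M))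
    cont-split⁺ j m M = trans (cont-split j (m ∷ M))
      (cong (λ b → 𝟙 b + (below j (m ∷ M) + (middle j (m ∷ M) + above j (m ∷ M)))) (null-++-∷ p m (M ++ q)))

    cont-split₁ : ∀ j a →
      cont j ⟪ a ∷ [] ⟫ ≡ below j (a ∷ []) + (𝟙 (allowed j a) * cont a ⟪ [] ⟫ + above j (a ∷ []))
    cont-split₁ j a = trans (cont-split⁺ j a [])
      (cong (λ t → below j (a ∷ []) + (t + above j (a ∷ []))) (+-identityʳ _))

    cont-split₂ : ∀ j a b → cont j ⟪ a ∷ b ∷ [] ⟫ ≡
      below j (a ∷ b ∷ []) + (𝟙 (allowed j a) * cont a ⟪ b ∷ [] ⟫ + 𝟙 (allowed j b) * cont b ⟪ a ∷ [] ⟫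
                              + above j (a ∷ b ∷ []))
    cont-split₂ j a b = trans (cont-split⁺ j a (b ∷ []))
      (cong (λ t → below j (a ∷ b ∷ []) + (t + above j (a ∷ b ∷ [])))
            (trans (sym (+-assoc (𝟙 (allowed j a) * cont a ⟪ b ∷ [] ⟫) _ 0)) (+-identityʳ _)))

    below-descent : ∀ {j} M → B ≤ j → below j M ≡ below B M
    below-descent {j} M B≤j = ∑-cong-local (All.map same-weight (All-picks p-low))
      where
      same-weight : ∀ {(h , r) : ℕ × List ℕ} → Low h × All Low r →
                    𝟙 (allowed j h) * cont h (r ++ M ++ q) ≡ 𝟙 (allowed B h) * cont h (r ++ M ++ q)
      same-weight (h<B , _) = trans (descent-weight _ (<-≤-trans h<B B≤j)) (sym (descent-weight _ h<B))

    above-ascent : ∀ {j} M → j ≤ 2 + B → above j M ≡ 𝟙 (isOdd j) * evenAbove M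
    above-ascent {j} M j≤B+2 =
      trans (∑-cong-local (All.map split-weight (All-picks q-high))) (∑-*ˡ (picks q) (𝟙 (isOdd j)) _)
      where
      split-weight : ∀ {(h , r) : ℕ × List ℕ} → High h × All High r →
                     𝟙 (allowed j h) * cont h (p ++ M ++ r) ≡ 𝟙 (isOdd j) * (𝟙 (isEven h) * cont h (p ++ M ++ r))
      split-weight {h , r} (B+2<h , _) = begin
        𝟙 (allowed j h) * c                 ≡⟨ cong (λ b → 𝟙 b * c) (allowed-ascent (≤-<-trans j≤B+2 B+2<h)) ⟩
        𝟙 (isOdd j ∧ isEven h) * c          ≡⟨ cong (_* c) (𝟙-∧ (isOdd j) (isEven h)) ⟩
        𝟙 (isOdd j) * 𝟙 (isEven h) * c      ≡⟨ *-assoc (𝟙 (isOdd j)) _ c ⟩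
        𝟙 (isOdd j) * (𝟙 (isEven h) * c)    ∎
        where c = cont h (p ++ M ++ r)

    above-B : ∀ M → above B M ≡ 0
    above-B M = trans (above-ascent M (<⇒≤ B<B+2)) (cong (λ b → 𝟙 b * evenAbove M) B-isOdd)

    above-B+1 : ∀ M → above (1 + B) M ≡ evenAbove M
    above-B+1 M = trans (above-ascent M (n≤1+n (1 + B)))
                        (trans (cong (λ b → 𝟙 b * evenAbove M) B+1-isOdd) (*-identityˡ _))

    above-B+2 : ∀ M → above (2 + B) M ≡ 0
    above-B+2 M = trans (above-ascent M ≤-refl) (cong (λ b → 𝟙 b * evenAbove M) B-isOdd)

    cont-B : cont B ⟪ [] ⟫ ≡ 𝟙 (null (p ++ q)) + below B []
    cont-B = trans (cont-split B [])
      (cong (λ t → 𝟙 (null (p ++ q)) + t) (trans (cong (below B [] +_) (above-B [])) (+-identityʳ _)))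

    cont-B+2 : cont (2 + B) ⟪ [] ⟫ ≡ cont B ⟪ [] ⟫
    cont-B+2 = B+2↦B-first (++⁺ (All.map inj₁ p-low) (All.map inj₂ q-high))

    cont-B+1 : cont (1 + B) ⟪ [] ⟫ ≡ cont B ⟪ [] ⟫ + evenAbove []
    cont-B+1 = begin
      cont (1 + B) ⟪ [] ⟫
        ≡⟨ cont-split (1 + B) [] ⟩
      N + (below (1 + B) [] + above (1 + B) [])
        ≡⟨ cong₂ (λ s t → N + (s + t)) (below-descent [] (n≤1+n B)) (above-B+1 []) ⟩
      N + (below B [] + evenAbove [])
        ≡⟨ sym (+-assoc N _ _) ⟩
      N + below B [] + evenAbove []
        ≡⟨ cong (_+ evenAbove []) (sym cont-B) ⟩
      cont B ⟪ [] ⟫ + evenAbove [] ∎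
      where N = 𝟙 (null (p ++ q))

    cont-B-[B+1] : cont B ⟪ 1 + B ∷ [] ⟫ ≡ below B (1 + B ∷ [])
    cont-B-[B+1] = trans (cont-split₁ B (1 + B))
      (trans (cong₂ (λ b t → below B (1 + B ∷ []) + (𝟙 b * cont (1 + B) ⟪ [] ⟫ + t)) B-to-B+1 (above-B (1 + B ∷ [])))
             (+-identityʳ _))

    cont-B+2-[B+1] : cont (2 + B) ⟪ 1 + B ∷ [] ⟫ ≡ cont B ⟪ 1 + B ∷ [] ⟫ + cont (1 + B) ⟪ [] ⟫
    cont-B+2-[B+1] = begin
      cont (2 + B) ⟪ 1 + B ∷ [] ⟫
        ≡⟨ cont-split₁ (2 + B) (1 + B) ⟩
      below (2 + B) (1 + B ∷ []) + (𝟙 (allowed (2 + B) (1 + B)) * cont (1 + B) ⟪ [] ⟫ + above (2 + B) (1 + B ∷ []))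
        ≡⟨ cong₂ _+_ (below-descent (1 + B ∷ []) (<⇒≤ B<B+2))
                     (cong₂ _+_ (descent-weight _ (n<1+n (1 + B))) (above-B+2 (1 + B ∷ []))) ⟩
      below B (1 + B ∷ []) + (cont (1 + B) ⟪ [] ⟫ + 0)
        ≡⟨ cong₂ _+_ (sym cont-B-[B+1]) (+-identityʳ _) ⟩
      cont B ⟪ 1 + B ∷ [] ⟫ + cont (1 + B) ⟪ [] ⟫ ∎

    cont-B+1-[B+2] : cont (1 + B) ⟪ 2 + B ∷ [] ⟫ ≡ cont (1 + B) ⟪ B ∷ [] ⟫
    cont-B+1-[B+2] = begin
      cont (1 + B) ⟪ 2 + B ∷ [] ⟫
        ≡⟨ cont-split₁ (1 + B) (2 + B) ⟩
      below (1 + B) (2 + B ∷ []) + (𝟙 (allowed (1 + B) (2 + B)) * cont (2 + B) ⟪ [] ⟫ + above (1 + B) (2 + B ∷ []))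
        ≡⟨ cong₂ _+_ (∑-cong-local (All.map below-swap (All-picks p-low)))
                     (cong₂ _+_ (cong₂ (λ b c → 𝟙 b * c) (trans B+1-to-B+2 (sym (allowed-descent (n<1+n B)))) cont-B+2)
                                (∑-cong-local (All.map above-swap (All-picks q-high)))) ⟩
      below (1 + B) (B ∷ []) + (𝟙 (allowed (1 + B) B) * cont B ⟪ [] ⟫ + above (1 + B) (B ∷ []))
        ≡⟨ sym (cont-split₁ (1 + B) B) ⟩
      cont (1 + B) ⟪ B ∷ [] ⟫ ∎
      where
      below-swap : ∀ {(h , r) : ℕ × List ℕ} → Low h × All Low r →
        𝟙 (allowed (1 + B) h) * cont h (r ++ 2 + B ∷ q) ≡ 𝟙 (allowed (1 + B) h) * cont h (r ++ B ∷ q)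
      below-swap {h , _} (h<B , r-low) = cong (𝟙 (allowed (1 + B) h) *_)
        (B+2↦B-inside (inj₁ h<B) (All.map inj₁ r-low) (All.map inj₂ q-high))
      above-swap : ∀ {(h , r) : ℕ × List ℕ} → High h × All High r →
        𝟙 (allowed (1 + B) h) * cont h (p ++ 2 + B ∷ r) ≡ 𝟙 (allowed (1 + B) h) * cont h (p ++ B ∷ r)
      above-swap {h , _} (B+2<h , r-high) = cong (𝟙 (allowed (1 + B) h) *_)
        (B+2↦B-inside (inj₂ B+2<h) (All.map inj₁ p-low) (All.map inj₂ r-high))

    cont-B-[B+1,B+2] : cont B ⟪ 1 + B ∷ 2 + B ∷ [] ⟫ ≡ below B (1 + B ∷ 2 + B ∷ [])
    cont-B-[B+1,B+2] = trans (cont-split₂ B (1 + B) (2 + B))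
      (trans (cong₂ (λ s t → below B (1 + B ∷ 2 + B ∷ []) + (s + t))
                    (cong₂ (λ b c → 𝟙 b * cont (1 + B) ⟪ 2 + B ∷ [] ⟫ + 𝟙 c * cont (2 + B) ⟪ 1 + B ∷ [] ⟫)
                           B-to-B+1 B-to-B+2)
                    (above-B (1 + B ∷ 2 + B ∷ [])))
             (+-identityʳ _))

    cont-B+2-[B,B+1] : cont (2 + B) ⟪ B ∷ 1 + B ∷ [] ⟫
                       ≡ below B (B ∷ 1 + B ∷ []) + (cont B ⟪ 1 + B ∷ [] ⟫ + cont (1 + B) ⟪ B ∷ [] ⟫)
    cont-B+2-[B,B+1] = begin
      cont (2 + B) ⟪ B ∷ 1 + B ∷ [] ⟫
        ≡⟨ cont-split₂ (2 + B) B (1 + B) ⟩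
      below (2 + B) (B ∷ 1 + B ∷ [])
        + (𝟙 (allowed (2 + B) B) * cont B ⟪ 1 + B ∷ [] ⟫ + 𝟙 (allowed (2 + B) (1 + B)) * cont (1 + B) ⟪ B ∷ [] ⟫
           + above (2 + B) (B ∷ 1 + B ∷ []))
        ≡⟨ cong₂ _+_ (below-descent (B ∷ 1 + B ∷ []) (<⇒≤ B<B+2))
                     (cong₂ _+_ (cong₂ _+_ (descent-weight _ B<B+2) (descent-weight _ (n<1+n (1 + B))))
                                (above-B+2 (B ∷ 1 + B ∷ []))) ⟩
      below B (B ∷ 1 + B ∷ []) + (cont B ⟪ 1 + B ∷ [] ⟫ + cont (1 + B) ⟪ B ∷ [] ⟫ + 0)
        ≡⟨ cong (below B (B ∷ 1 + B ∷ []) +_) (+-identityʳ _) ⟩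
      below B (B ∷ 1 + B ∷ []) + (cont B ⟪ 1 + B ∷ [] ⟫ + cont (1 + B) ⟪ B ∷ [] ⟫) ∎

    cont-B+1-[B] : cont (1 + B) ⟪ B ∷ [] ⟫ ≡ below B (B ∷ []) + (cont B ⟪ [] ⟫ + evenAbove (B ∷ []))
    cont-B+1-[B] = trans (cont-split₁ (1 + B) B)
      (cong₂ _+_ (below-descent (B ∷ []) (n≤1+n B)) (cong₂ _+_ (descent-weight _ (n<1+n B)) (above-B+1 (B ∷ []))))

    startsEvenFrom-split : ∀ M →
      startsEvenFrom B ⟪ M ⟫ ≡ ∑ (picks M) (λ (h , r) → 𝟙 (isEvenFrom B h) * cont h ⟪ r ⟫) + evenAbove M
    startsEvenFrom-split M = begin
      ∑ (picks ⟪ M ⟫) W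
        ≡⟨ trans (∑-picks-++ p (M ++ q) W) (cong (∑ (picks p) (λ (h , r) → W (h , r ++ M ++ q)) +_) (∑-picks-++ M q _)) ⟩
      ∑ (picks p) (λ (h , r) → W (h , r ++ M ++ q))
        + (∑ (picks M) (λ (h , r) → W (h , ⟪ r ⟫)) + ∑ (picks q) (λ (h , r) → W (h , p ++ M ++ r)))
        ≡⟨ cong₂ (λ s t → s + (∑ (picks M) (λ (h , r) → W (h , ⟪ r ⟫)) + t))
                 (∑-zero (All.map weight-below (All-picks p-low))) (∑-cong-local (All.map weight-above (All-picks q-high))) ⟩
      ∑ (picks M) (λ (h , r) → W (h , ⟪ r ⟫)) + evenAbove M ∎
      where
      W : ℕ × List ℕ → ℕ
      W (h , r) = 𝟙 (isEvenFrom B h) * cont h r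
      weight-below : ∀ {(h , r) : ℕ × List ℕ} → Low h × All Low r → W (h , r ++ M ++ q) ≡ 0
      weight-below {h , r} (h<B , _) = cong (λ b → 𝟙 b * cont h (r ++ M ++ q))
        (trans (cong (isEven h ∧_) (≤ᵇ-false h<B)) (∧-zeroʳ (isEven h)))
      weight-above : ∀ {(h , r) : ℕ × List ℕ} → High h × All High r →
                     W (h , p ++ M ++ r) ≡ 𝟙 (isEven h) * cont h (p ++ M ++ r)
      weight-above {h , r} (B+2<h , _) = cong (λ b → 𝟙 b * cont h (p ++ M ++ r))
        (trans (cong (isEven h ∧_) (≤ᵇ-true (<⇒≤ (<-trans B<B+2 B+2<h)))) (∧-identityʳ (isEven h)))

    middle-low : ∀ {j} → Low j →
      middle j (1 + B ∷ 2 + B ∷ []) + 0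
        ≡ middle j (B ∷ 1 + B ∷ []) + middle j (B ∷ []) + middle j (1 + B ∷ []) + above j []
    middle-low {j} j<B
      rewrite Low-to-B j<B | Low-to-B+1 j<B | Low-to-B+2 j<B | above-ascent {j} [] (<⇒≤ (<-trans j<B B<B+2))
            | cont-B+2-[B+1] | cont-B+1
      = distribute (𝟙 (isOdd j)) (cont B ⟪ 1 + B ∷ [] ⟫) (cont B ⟪ [] ⟫) (evenAbove [])
      where
      distribute : ∀ o y c e → o * (y + (c + e)) + 0 + 0 ≡ o * y + 0 + (o * c + 0) + 0 + o * e
      distribute = solve-∀

    middle-high : ∀ {j} → High j →
      middle j (1 + B ∷ 2 + B ∷ []) + cont j ⟪ [] ⟫
        ≡ middle j (B ∷ 1 + B ∷ []) + middle j (B ∷ []) + middle j (1 + B ∷ []) + above j []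
    middle-high {j} B+2<j
      rewrite allowed-descent (<-trans B<B+2 B+2<j) | allowed-descent (<-trans (n<1+n (1 + B)) B+2<j)
            | allowed-descent B+2<j
            | cont-B+1-[B+2] | cont-B+2-[B+1] | cont-split j [] | below-descent {j} [] (<⇒≤ (<-trans B<B+2 B+2<j))
            | cont-B
      = regroup (cont (1 + B) ⟪ B ∷ [] ⟫) (cont B ⟪ 1 + B ∷ [] ⟫) (cont (1 + B) ⟪ [] ⟫) (𝟙 (null (p ++ q)))
                (below B []) (above j [])
      where
      regroup : ∀ w y v n b a →
                1 * w + (1 * (y + v) + 0) + (n + (b + a)) ≡ 1 * y + (1 * w + 0) + (1 * (n + b) + 0) + (1 * v + 0) + a
      regroup = solve-∀

    below-crossing : ∀ j → All (λ (h , r) → LowCrossing h r q) (picks p) →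
      below j (1 + B ∷ 2 + B ∷ []) ≡ below j (B ∷ 1 + B ∷ []) + below j (B ∷ []) + below j (1 + B ∷ [])
    below-crossing j ih = ∑-linear (λ (h , _) → 𝟙 (allowed j h)) ih

    above-crossing : ∀ j → All (λ (h , r) → HighCrossing h p r) (picks q) →
      above j (1 + B ∷ 2 + B ∷ []) + above j [] ≡ above j (B ∷ 1 + B ∷ []) + above j (B ∷ []) + above j (1 + B ∷ [])
    above-crossing j ih = begin
      above j (1 + B ∷ 2 + B ∷ []) + above j []
        ≡⟨ sym (∑-+ (picks q) _ _) ⟩
      ∑ (picks q) (λ (h , r) → 𝟙 (allowed j h) * cont h (p ++ 1 + B ∷ 2 + B ∷ r) + 𝟙 (allowed j h) * cont h (p ++ r))
        ≡⟨ ∑-cong (picks q) (λ (h , r) → sym (*-distribˡ-+ (𝟙 (allowed j h)) _ _)) ⟩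
      ∑ (picks q) (λ (h , r) → 𝟙 (allowed j h) * (cont h (p ++ 1 + B ∷ 2 + B ∷ r) + cont h (p ++ r)))
        ≡⟨ ∑-linear (λ (h , _) → 𝟙 (allowed j h)) ih ⟩
      above j (B ∷ 1 + B ∷ []) + above j (B ∷ []) + above j (1 + B ∷ []) ∎

    crossing-from-parts : ∀ j {E} →
      below j (1 + B ∷ 2 + B ∷ []) ≡ below j (B ∷ 1 + B ∷ []) + below j (B ∷ []) + below j (1 + B ∷ []) →
      middle j (1 + B ∷ 2 + B ∷ []) + E
        ≡ middle j (B ∷ 1 + B ∷ []) + middle j (B ∷ []) + middle j (1 + B ∷ []) + above j [] →
      above j (1 + B ∷ 2 + B ∷ []) + above j [] ≡ above j (B ∷ 1 + B ∷ []) + above j (B ∷ []) + above j (1 + B ∷ []) →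
      cont j ⟪ 1 + B ∷ 2 + B ∷ [] ⟫ + E ≡ crossing-rhs j p q
    crossing-from-parts j {E} hb hm ha = begin
      cont j ⟪ 1 + B ∷ 2 + B ∷ [] ⟫ + E
        ≡⟨ cong (_+ E) (cont-split⁺ j (1 + B) (2 + B ∷ [])) ⟩
      total (1 + B ∷ 2 + B ∷ []) + E
        ≡⟨ combine (below j) (middle j) (above j) (1 + B ∷ 2 + B ∷ []) (B ∷ 1 + B ∷ []) (B ∷ []) (1 + B ∷ []) hb hm ha ⟩
      total (B ∷ 1 + B ∷ []) + total (B ∷ []) + total (1 + B ∷ [])
        ≡⟨ sym (cong₂ _+_ (cong₂ _+_ (cont-split⁺ j B (1 + B ∷ [])) (cont-split⁺ j B [])) (cont-split⁺ j (1 + B) [])) ⟩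
      crossing-rhs j p q ∎
      where
      total : List ℕ → ℕ
      total M = below j M + (middle j M + above j M)

    recurrence-frame : All (λ (h , r) → LowCrossing h r q) (picks p) →
      cont (2 + B) ⟪ B ∷ 1 + B ∷ [] ⟫ ≡ cont B ⟪ 1 + B ∷ 2 + B ∷ [] ⟫ + (cont B ⟪ [] ⟫ + evenAbove (B ∷ []))
    recurrence-frame ih = begin
      cont (2 + B) ⟪ B ∷ 1 + B ∷ [] ⟫
        ≡⟨ cont-B+2-[B,B+1] ⟩
      below B (B ∷ 1 + B ∷ []) + (cont B ⟪ 1 + B ∷ [] ⟫ + cont (1 + B) ⟪ B ∷ [] ⟫)
        ≡⟨ cong₂ (λ s t → below B (B ∷ 1 + B ∷ []) + (s + t)) cont-B-[B+1] cont-B+1-[B] ⟩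
      below B (B ∷ 1 + B ∷ []) + (below B (1 + B ∷ []) + (below B (B ∷ []) + rest))
        ≡⟨ regroup (below B (B ∷ 1 + B ∷ [])) (below B (1 + B ∷ [])) (below B (B ∷ [])) rest ⟩
      below B (B ∷ 1 + B ∷ []) + below B (B ∷ []) + below B (1 + B ∷ []) + rest
        ≡⟨ cong (_+ rest) (sym (trans cont-B-[B+1,B+2] (below-crossing B ih))) ⟩
      cont B ⟪ 1 + B ∷ 2 + B ∷ [] ⟫ + rest ∎
      where
      rest = cont B ⟪ [] ⟫ + evenAbove (B ∷ [])
      regroup : ∀ a b c d → a + (b + (c + d)) ≡ a + c + b + d
      regroup = solve-∀

  crossing : ∀ n p q → length p + length q < n → All Low p → All High q →
             (∀ {j} → Low j → LowCrossing j p q) × (∀ {j} → High j → HighCrossing j p q)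
  crossing (suc n) p q size p-low q-high = low-crossing , high-crossing
    where
    open Frame p q p-low q-high

    ih-below : All (λ (h , r) → LowCrossing h r q) (picks p)
    ih-below = All.zipWith (λ {(h , r)} ((h<B , r-low) , r<p) → proj₁ (crossing n r q (shorter {r} r<p) r-low q-high) h<B)
                           (All-picks p-low , picks-length p)
      where
      shorter : ∀ {r} → suc (length r) ≡ length p → length r + length q < n
      shorter {r} eq = subst (_≤ n) (cong (_+ length q) (sym eq)) (m<1+n⇒m≤n size)

    ih-above : All (λ (h , r) → HighCrossing h p r) (picks q)
    ih-above = All.zipWith (λ {(h , r)} ((B+2<h , r-high) , r<q) → proj₂ (crossing n p r (shorter {r} r<q) p-low r-high) B+2<h)
                           (All-picks q-high , picks-length q)
      where
      shorter : ∀ {r} → suc (length r) ≡ length q → length p + length r < n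
      shorter {r} eq = subst (_≤ n) (trans (cong (length p +_) (sym eq)) (+-suc (length p) (length r))) (m<1+n⇒m≤n size)

    low-crossing : ∀ {j} → Low j → LowCrossing j p q
    low-crossing {j} j<B = trans (sym (+-identityʳ _))
      (crossing-from-parts j (below-crossing j ih-below) (middle-low j<B) (above-crossing j ih-above))

    high-crossing : ∀ {j} → High j → HighCrossing j p q
    high-crossing {j} B+2<j =
      crossing-from-parts j (below-crossing j ih-below) (middle-high B+2<j) (above-crossing j ih-above)

  low-crossings : ∀ {p q} → All Low p → All High q → All (λ (h , r) → LowCrossing h r q) (picks p)
  low-crossings {p} {q} p-low q-high =
    All.map (λ {(h , r)} (h<B , r-low) → proj₁ (crossing _ r q ≤-refl r-low q-high) h<B) (All-picks p-low)

Recurrence : ℕ → ℕ → Set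
Recurrence n k = G (2 * n) (2 * k + 2) ≡ G (2 * n) (2 * k) + sumFromTo k n (λ i → G (2 * n ∸ 2) (2 * i))

-- For k = 0 the value B = 0 does not occur in [1..2n], so the frame has p = [] and no middle value B.
recurrence-zero : ∀ m → Recurrence (2 + m) 0
recurrence-zero m = begin
  G (2 * (2 + m)) 2          ≡⟨ G-cont (1 ∷ []) q (cong (interval 1) (*-suc 2 (suc m))) (s≤s (s≤s z≤n) ∷ []) q-high ⟩
  cont 2 (1 ∷ q)             ≡⟨ cont-B+2-[B+1] ⟩
  cont 0 (1 ∷ q) + cont 1 q  ≡⟨ cong₂ _+_ cont-B-[B+1] (trans cont-B+1 (cong (_+ evenAbove []) cont-B)) ⟩
  evenAbove []               ≡⟨ sym (startsEvenFrom-split []) ⟩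
  startsEvenFrom 0 q         ≡⟨ sym (sumFromTo-startsEvenFrom 0 (suc m)) ⟩
  sumFromTo 0 (2 + m) F      ≡⟨ cong (_+ sumFromTo 0 (2 + m) F) (sym (G-zero (2 * (2 + m)))) ⟩
  G (2 * (2 + m)) 0 + sumFromTo 0 (2 + m) F ∎
  where
  F = λ i → G (2 * (2 + m) ∸ 2) (2 * i)
  q = interval 3 (2 * suc m)
  q-high = interval-lower 3 (2 * suc m)
  open Crossing 0 even-zero
  open Frame [] q [] q-high

recurrence-suc : ∀ k m → Recurrence (suc k + suc m) (suc k)
recurrence-suc k m = begin
  G (2 * n) (B + 2)                               ≡⟨ cong (G (2 * n)) (+-comm B 2) ⟩
  G (2 * n) (2 + B)                               ≡⟨ G-cont (p ++ B ∷ 1 + B ∷ []) q layout-B+2 below-B+2 q-high ⟩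
  cont (2 + B) ((p ++ B ∷ 1 + B ∷ []) ++ q)       ≡⟨ cong (cont (2 + B)) (++-assoc p (B ∷ 1 + B ∷ []) q) ⟩
  cont (2 + B) ⟪ B ∷ 1 + B ∷ [] ⟫                 ≡⟨ recurrence-frame (low-crossings p-low q-high) ⟩
  cont B ⟪ 1 + B ∷ 2 + B ∷ [] ⟫ + (cont B ⟪ [] ⟫ + evenAbove (B ∷ []))
                                                  ≡⟨ cong₂ _+_ (sym G-at-B) (sym sum-from-k) ⟩
  G (2 * n) B + sumFromTo (suc k) n F             ∎
  where
  n = suc k + suc m
  F = λ i → G (2 * n ∸ 2) (2 * i)
  B = 2 * suc k
  p = interval 1 (pred B)
  q = interval (3 + B) (2 * m)
  p-low = interval-upper 1 (pred B)
  q-high = interval-lower (3 + B) (2 * m)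
  open Crossing B (even-double (suc k))
  open Frame p q p-low q-high

  layout : interval 1 (2 * n) ≡ p ++ B ∷ 1 + B ∷ 2 + B ∷ q
  layout = trans (cong (interval 1) size) (interval-++ 1 (pred B) (3 + 2 * m))
    where
    size : 2 * n ≡ pred B + (3 + 2 * m)
    size = trans (*-distribˡ-+ 2 (suc k) (suc m)) (trans (cong (B +_) (*-suc 2 m)) (sym (+-suc (pred B) (2 + 2 * m))))

  layout-B+2 : interval 1 (2 * n) ≡ (p ++ B ∷ 1 + B ∷ []) ++ 2 + B ∷ q
  layout-B+2 = trans layout (sym (++-assoc p (B ∷ 1 + B ∷ []) (2 + B ∷ q)))

  below-B+2 : All (_< 2 + B) (p ++ B ∷ 1 + B ∷ [])
  below-B+2 = ++⁺ (All.map (λ u<B → <-trans u<B B<B+2) p-low) (B<B+2 ∷ n<1+n (1 + B) ∷ [])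

  G-at-B : G (2 * n) B ≡ cont B ⟪ 1 + B ∷ 2 + B ∷ [] ⟫
  G-at-B = G-cont p (1 + B ∷ 2 + B ∷ q) layout p-low (n<1+n B ∷ B<B+2 ∷ All.map (<-trans B<B+2) q-high)

  sum-from-k : sumFromTo (suc k) n F ≡ cont B ⟪ [] ⟫ + evenAbove (B ∷ [])
  sum-from-k = begin
    sumFromTo (suc k) n F
      ≡⟨ sumFromTo-startsEvenFrom (suc k) m ⟩
    startsEvenFrom B (interval 1 B ++ q)
      ≡⟨ cong (λ xs → startsEvenFrom B (xs ++ q)) (interval-∷ʳ 1 (pred B)) ⟩
    startsEvenFrom B ((p ++ B ∷ []) ++ q)
      ≡⟨ cong (startsEvenFrom B) (++-assoc p (B ∷ []) q) ⟩
    startsEvenFrom B ⟪ B ∷ [] ⟫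
      ≡⟨ startsEvenFrom-split (B ∷ []) ⟩
    𝟙 (isEvenFrom B B) * cont B ⟪ [] ⟫ + 0 + evenAbove (B ∷ [])
      ≡⟨ cong (λ b → 𝟙 b * cont B ⟪ [] ⟫ + 0 + evenAbove (B ∷ []))
              (trans (cong (_∧ (B ≤ᵇ B)) B-isEven) (≤ᵇ-true (≤-refl {B}))) ⟩
    1 * cont B ⟪ [] ⟫ + 0 + evenAbove (B ∷ [])
      ≡⟨ cong (_+ evenAbove (B ∷ [])) (trans (+-identityʳ _) (*-identityˡ _)) ⟩
    cont B ⟪ [] ⟫ + evenAbove (B ∷ []) ∎

recurrence : ∀ k m → 2 ≤ k + suc m → Recurrence (k + suc m) k
recurrence zero    zero    (s≤s ())
recurrence zero    (suc m) _ = recurrence-zero m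
recurrence (suc k) m       _ = recurrence-suc k m

theorem1p6 : ∀ (n k : ℕ) → 2 ≤ n → k < n →
    G (2 * n) (2 * k + 2) ≡ G (2 * n) (2 * k) + sumFromTo k n (λ i → G (2 * n ∸ 2) (2 * i))
theorem1p6 n k 2≤n k<n with m≤n⇒∃[o]m+o≡n k<n
... | m , refl = subst (λ n → Recurrence n k) (+-suc k m) (recurrence k m (subst (2 ≤_) (sym (+-suc k m)) 2≤n))
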